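{- Let $G$ be a connected graph with $n$ vertices and diameter $d\ge 2$. Then $$\sigma_2(G)\le \binom{n-d}{2}d^2+2(n-d-1)d^2+d^3.$$ Moreover, this upper bound is asymptotically sharp when $d$ is bounded by a constant fraction of $n$: for every fixed $c\in(0,1)$, the ratio of $\max\{\sigma_2(B_{n,d}),\sigma_2(B'_{n,d})\}$ to the bound tends to $1$ as $n\to\infty$, uniformly over $2\le d\le cn$.
   Context: Graphs are finite, simple and undirected. For a connected graph $G$ and vertex $u$, $\varepsilon_G(u)=\max_{v\in V(G)}d_G(u,v)$ is the eccentricity of $u$. The second Zagreb eccentricity index is $\sigma_2(G)=\sum_{uv\in E(G)}\varepsilon_G(u)\varepsilon_G(v)$. For $n>d\ge 2$, $B_{n,d}$ is the graph obtained from a path with vertices $v_0,v_1,\dots,v_d$ (in order) by adding $n-d-1$ new pairwise adjacent vertices, each also adjacent to $v_0$ and $v_1$; $B'_{n,d}$ is obtained from the same path by adding $n-d-1$ new pairwise adjacent vertices, each also adjacent to $v_0$, $v_1$ and $v_2$. Both have $n$ vertices and diameter $d$.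
   Formalization: In the sharpness clause the fixed fraction c ranges over the rationals in (0,1) rather than over all real numbers in (0,1). -}

module Defs where

open import Data.Nat using (ℕ; zero; suc; _+_; _*_; _∸_; _⊔_; _≤_; _<_; _≡ᵇ_; _≤ᵇ_)
open import Data.Nat.Combinatorics using (_C_)
open import Data.Bool using (Bool; true; false; _∧_; _∨_; if_then_else_; not)
open import Data.Fin using (Fin; toℕ)
open import Data.List using (List; []; _∷_; map; foldr; allFin; concatMap)
open import Data.Bool.ListAction using (any)
open import Data.Nat.ListAction using (sum)
open import Data.Nat.Properties using (+-comm; n∸n≡0; ≡ᵇ⇒≡; ≡⇒≡ᵇ)
open import Relation.Binary.PropositionalEquality using (refl; cong; sym)
open import Relation.Binary.PropositionalEquality using (_≡_)

record Graph (n : ℕ) : Set where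
  field
    adj     : Fin n → Fin n → Bool
    adj-sym : ∀ u v → adj u v ≡ adj v u
    adj-irr : ∀ u → adj u u ≡ false
open Graph public

module _ {n : ℕ} (G : Graph n) where

  reach : ℕ → Fin n → Fin n → Bool
  reach zero    u v = toℕ u ≡ᵇ toℕ v
  reach (suc k) u v = reach k u v ∨ any (λ w → reach k u w ∧ adj G w v) (allFin n)

  Connected : Set
  Connected = ∀ u v → reach n u v ≡ true

-- least k in [start, start+b) with f k = true (or start+b if none)
findFrom : (ℕ → Bool) → ℕ → ℕ → ℕ
findFrom f zero    k = k
findFrom f (suc b) k = if f k then k else findFrom f b (suc k)

maxList : List ℕ → ℕ
maxList = foldr _⊔_ 0

module _ {n : ℕ} (G : Graph n) where

  -- distance d_G(u,v) = least k such that a walk of length ≤ k joins u and v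
  -- (meaningful for connected G, where it is < n)
  dist : Fin n → Fin n → ℕ
  dist u v = findFrom (λ k → reach G k u v) n 0

  ecc : Fin n → ℕ
  ecc u = maxList (map (dist u) (allFin n))

  diam : ℕ
  diam = maxList (map ecc (allFin n))

  σ₂ : ℕ
  σ₂ = sum (concatMap (λ u → map (λ v → if adj G u v ∧ (suc (toℕ u) ≤ᵇ toℕ v)
                                           then ecc u * ecc v else 0)
                                  (allFin n))
                      (allFin n))

bound : ℕ → ℕ → ℕ
bound n d = ((n ∸ d) C 2) * (d * d) + 2 * (n ∸ d ∸ 1) * (d * d) + d * d * d

-- Adjacency of B_{n,d} / B'_{n,d} on labels ℕ:
-- labels 0..d are the path v_0..v_d, labels d+1..n-1 are the added clique
-- vertices, each adjacent to v_i for i < t (t = 2 for B, t = 3 for B').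
absDiff : ℕ → ℕ → ℕ
absDiff a b = (a ∸ b) + (b ∸ a)

adjBℕ : ℕ → ℕ → ℕ → ℕ → Bool
adjBℕ t d a b with a ≤ᵇ d | b ≤ᵇ d
... | true  | true  = absDiff a b ≡ᵇ 1
... | true  | false = suc a ≤ᵇ t
... | false | true  = suc b ≤ᵇ t
... | false | false = not (a ≡ᵇ b)

absDiff-sym : ∀ a b → absDiff a b ≡ absDiff b a
absDiff-sym a b = +-comm (a ∸ b) (b ∸ a)

≡ᵇ-sym : ∀ a b → (a ≡ᵇ b) ≡ (b ≡ᵇ a)
≡ᵇ-sym zero zero = refl
≡ᵇ-sym zero (suc b) = refl
≡ᵇ-sym (suc a) zero = refl
≡ᵇ-sym (suc a) (suc b) = ≡ᵇ-sym a b

≡ᵇ-refl : ∀ a → (a ≡ᵇ a) ≡ true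
≡ᵇ-refl zero = refl
≡ᵇ-refl (suc a) = ≡ᵇ-refl a

adjBℕ-sym : ∀ t d a b → adjBℕ t d a b ≡ adjBℕ t d b a
adjBℕ-sym t d a b with a ≤ᵇ d | b ≤ᵇ d
... | true  | true  = cong (_≡ᵇ 1) (absDiff-sym a b)
... | true  | false = refl
... | false | true  = refl
... | false | false = cong not (≡ᵇ-sym a b)

adjBℕ-irr : ∀ t d a → adjBℕ t d a a ≡ false
adjBℕ-irr t d a with a ≤ᵇ d
... | true  rewrite n∸n≡0 a = refl
... | false rewrite ≡ᵇ-refl a = refl

Bgraph : ℕ → (n d : ℕ) → Graph n
Bgraph t n d = record
  { adj     = λ u v → adjBℕ t d (toℕ u) (toℕ v)
  ; adj-sym = λ u v → adjBℕ-sym t d (toℕ u) (toℕ v)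
  ; adj-irr = λ u → adjBℕ-irr t d (toℕ u)
  }

B : (n d : ℕ) → Graph n
B = Bgraph 2

B′ : (n d : ℕ) → Graph n
B′ = Bgraph 3

-- Every edge contributes at most D² to σ₂, where D is the diameter, so it suffices to show that G
-- has at most D + 3A + C(A,2) edges, where A = n − D − 1. Take a diametral pair u₀, v₀ and choose
-- one vertex on each distance level 0, …, D from u₀; A vertices remain unchosen. Charge every edge
-- to one endpoint: a chosen vertex pays only for an edge to the chosen vertex one level up (D edges
-- in all); an unchosen vertex pays for its edges to chosen vertices, which lie on its own or an
-- adjacent level (at most three), and for its edges to later unchosen vertices (C(A,2) in all).
--
-- For sharpness, the position along the path is a potential that changes by at most one along
-- edges; it shows that B_{n,d} has diameter d and that its A = n − d − 1 clique vertices have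
-- eccentricity d, so σ₂(B_{n,d}) ≥ d² C(A,2). The bound is d² (C(A,2) + d + 3A), and A grows
-- linearly in n when d ≤ c n, so the linear terms become negligible.

module Submission where

open import Defs
open import Data.Nat
  using (ℕ; zero; suc; _+_; _*_; _∸_; _⊔_; _≤_; _<_; _≤ᵇ_; _<ᵇ_; _≡ᵇ_; z≤n; s≤s; _<?_; NonZero; >-nonZero)
open import Data.Nat.Properties
open import Data.Nat.Combinatorics using (_C_; nC1≡n; nCk+nC[k+1]≡[n+1]C[k+1])
open import Data.Nat.ListAction using () renaming (sum to listSum)
open import Data.Nat.ListAction.Properties using (sum-++)
open import Data.Nat.Solver using (module +-*-Solver)
open import Data.Bool using (Bool; true; false; _∧_; _∨_; not; if_then_else_; T)
open import Data.Bool.Properties using (∧-zeroʳ; ∧-identityʳ; T-≡; T-not-≡; T-∧; T-∨)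
open import Data.Fin using (Fin; toℕ; fromℕ<) renaming (zero to fzero; suc to fsuc; _≟_ to _≟ᶠ_)
open import Data.Fin.Properties using (toℕ-injective; toℕ<n; toℕ-fromℕ<)
open import Data.List using (List; []; _∷_; map; tabulate; allFin; concatMap)
open import Data.List.Properties using (map-tabulate)
open import Data.List.Membership.Propositional using (_∈_; find; lose)
open import Data.List.Membership.Propositional.Properties using (∈-map⁺; ∈-map⁻; ∈-allFin)
open import Data.List.Relation.Unary.Any using (here; there)
open import Data.List.Relation.Unary.Any.Properties using (any⁺; any⁻)
open import Data.Product using (_×_; _,_; ∃-syntax; proj₁; proj₂)
open import Data.Sum using (_⊎_; inj₁; inj₂)
open import Data.Empty using (⊥; ⊥-elim)
open import Function using (_∘_; id; case_of_; Equivalence)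
open Equivalence using (to; from)
open import Relation.Binary.PropositionalEquality
open import Relation.Binary.Definitions using (tri<; tri≈; tri>)
open import Relation.Nullary using (Dec; does; yes; no)
open import Relation.Nullary.Decidable using (dec-true; dec-false)
open import Algebra.Properties.Semiring.Sum +-*-semiring
  using (sum; sum-syntax; sum-cong-≗; sum-replicate-zero; ∑-distrib-+; ∑-comm; *-distribˡ-sum)

-- Indicator sums

𝟙 : Bool → ℕ
𝟙 true  = 1
𝟙 false = 0

𝟙-∧ : ∀ a b → 𝟙 (a ∧ b) ≡ 𝟙 a * 𝟙 b
𝟙-∧ true  b = sym (+-identityʳ (𝟙 b))
𝟙-∧ false b = refl

𝟙-+-not : ∀ b → 𝟙 b + 𝟙 (not b) ≡ 1
𝟙-+-not true  = refl
𝟙-+-not false = refl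

𝟙-mono : ∀ {a b} → (T a → T b) → 𝟙 a ≤ 𝟙 b
𝟙-mono {false}         a⇒b = z≤n
𝟙-mono {true}  {true}  a⇒b = ≤-refl
𝟙-mono {true}  {false} a⇒b = ⊥-elim (a⇒b _)

𝟙-cong : ∀ {a b} → (T a → T b) → (T b → T a) → 𝟙 a ≡ 𝟙 b
𝟙-cong a⇒b b⇒a = ≤-antisym (𝟙-mono a⇒b) (𝟙-mono b⇒a)

𝟙-∨ : ∀ a b → 𝟙 (a ∨ b) ≤ 𝟙 a + 𝟙 b
𝟙-∨ true  b = s≤s z≤n
𝟙-∨ false b = ≤-refl

*-𝟙-≤ : ∀ {c x} b → (T b → c ≤ x) → c * 𝟙 b ≤ x
*-𝟙-≤ {c} true  c≤x = ≤-trans (≤-reflexive (*-identityʳ c)) (c≤x _)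
*-𝟙-≤ {c} false c≤x = ≤-trans (≤-reflexive (*-zeroʳ c)) z≤n

∑-mono-≤ : ∀ {n} {f g : Fin n → ℕ} → (∀ i → f i ≤ g i) → sum f ≤ sum g
∑-mono-≤ {zero}  f≤g = z≤n
∑-mono-≤ {suc n} f≤g = +-mono-≤ (f≤g fzero) (∑-mono-≤ (f≤g ∘ fsuc))

∑-const-1 : ∀ n → ∑[ i < n ] 1 ≡ n
∑-const-1 zero    = refl
∑-const-1 (suc n) = cong suc (∑-const-1 n)

∑-*ˡ : ∀ {n} c (f : Fin n → ℕ) → ∑[ i < n ] (c * f i) ≡ c * sum f
∑-*ˡ c f = sym (*-distribˡ-sum c f)

T-does⁻ : ∀ {p} {P : Set p} (P? : Dec P) → T (does P?) → P
T-does⁻ (yes p) _ = p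

T-does⁺ : ∀ {p} {P : Set p} (P? : Dec P) → P → T (does P?)
T-does⁺ P? p = subst T (sym (dec-true P? p)) _

δ : ∀ {n} → Fin n → Fin n → ℕ
δ u v = 𝟙 (does (u ≟ᶠ v))

∑-δ : ∀ {n} (u : Fin n) → ∑[ v < n ] δ u v ≡ 1
∑-δ {suc n} fzero    = cong suc (sum-replicate-zero n)
∑-δ {suc n} (fsuc u) = ∑-δ u

∑-≡ᵇ : ∀ m x → ∑[ i < m ] 𝟙 (x ≡ᵇ toℕ i) ≡ 𝟙 (x <ᵇ m)
∑-≡ᵇ zero    x       = refl
∑-≡ᵇ (suc m) zero    = cong suc (sum-replicate-zero m)
∑-≡ᵇ (suc m) (suc x) = ∑-≡ᵇ m x

_≺_ : ∀ {n} → Fin n → Fin n → Bool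
u ≺ v = toℕ u <ᵇ toℕ v

[1+n]C2≡n+nC2 : ∀ a → suc a C 2 ≡ a + a C 2
[1+n]C2≡n+nC2 a = sym (trans (cong (_+ a C 2) (sym (nC1≡n a))) (nCk+nC[k+1]≡[n+1]C[k+1] a 1))

count : ∀ {n} → (Fin n → Bool) → ℕ
count {n} P = ∑[ u < n ] 𝟙 (P u)

count-pairs : ∀ {n} (P : Fin n → Bool) →
              ∑[ u < n ] ∑[ v < n ] 𝟙 (P u ∧ P v ∧ u ≺ v) ≡ count P C 2
count-pairs {zero}  P = refl
count-pairs {suc n} P = begin
  ∑[ u < suc n ] ∑[ v < suc n ] 𝟙 (P u ∧ P v ∧ u ≺ v)
    ≡⟨ cong₂ _+_ first-row (sum-cong-≗ {n} (λ u → cong (_+ rest u) (𝟙-∧-false (P (fsuc u)) p₀))) ⟩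
  𝟙 p₀ * m + ∑[ u < n ] rest u
    ≡⟨ cong (𝟙 p₀ * m +_) (count-pairs (P ∘ fsuc)) ⟩
  𝟙 p₀ * m + m C 2
    ≡⟨ add-first p₀ ⟩
  (𝟙 p₀ + m) C 2 ∎
  where
  open ≡-Reasoning
  p₀ = P fzero
  m = count (P ∘ fsuc)
  rest : Fin n → ℕ
  rest u = ∑[ v < n ] 𝟙 (P (fsuc u) ∧ P (fsuc v) ∧ u ≺ v)
  𝟙-∧-false : ∀ a b → 𝟙 (a ∧ b ∧ false) ≡ 0
  𝟙-∧-false a b = cong 𝟙 (trans (cong (a ∧_) (∧-zeroʳ b)) (∧-zeroʳ a))
  first-row : 𝟙 (p₀ ∧ p₀ ∧ false) + ∑[ v < n ] 𝟙 (p₀ ∧ P (fsuc v) ∧ true) ≡ 𝟙 p₀ * m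
  first-row = cong₂ _+_ (𝟙-∧-false p₀ p₀)
    (trans (sum-cong-≗ {n} (λ v → trans (cong (λ x → 𝟙 (p₀ ∧ x)) (∧-identityʳ _)) (𝟙-∧ p₀ _)))
           (∑-*ˡ (𝟙 p₀) (𝟙 ∘ P ∘ fsuc)))
  add-first : ∀ b → 𝟙 b * m + m C 2 ≡ (𝟙 b + m) C 2
  add-first true  = trans (cong (_+ m C 2) (+-identityʳ m)) (sym ([1+n]C2≡n+nC2 m))
  add-first false = refl

listSum-allFin : ∀ {n} (f : Fin n → ℕ) → listSum (map f (allFin n)) ≡ sum f
listSum-allFin f = trans (cong listSum (map-tabulate id f)) (listSum-tabulate f)
  where
  listSum-tabulate : ∀ {n} (f : Fin n → ℕ) → listSum (tabulate f) ≡ sum f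
  listSum-tabulate {zero}  f = refl
  listSum-tabulate {suc n} f = cong (f fzero +_) (listSum-tabulate (f ∘ fsuc))

listSum-concatMap : ∀ {a} {A : Set a} (F : A → List ℕ) xs →
                    listSum (concatMap F xs) ≡ listSum (map (listSum ∘ F) xs)
listSum-concatMap F []       = refl
listSum-concatMap F (x ∷ xs) = trans (sum-++ (F x) _) (cong (listSum (F x) +_) (listSum-concatMap F xs))

≤-maxList : ∀ {x xs} → x ∈ xs → x ≤ maxList xs
≤-maxList (here refl) = m≤m⊔n _ _
≤-maxList (there x∈xs) = ≤-trans (≤-maxList x∈xs) (m≤n⊔m _ _)

maxList-≤ : ∀ {m} xs → (∀ {x} → x ∈ xs → x ≤ m) → maxList xs ≤ m
maxList-≤ []       bound = z≤n
maxList-≤ (x ∷ xs) bound = ⊔-lub (bound (here refl)) (maxList-≤ xs (bound ∘ there))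

maxList-∈ : ∀ xs → 0 < maxList xs → maxList xs ∈ xs
maxList-∈ (x ∷ xs) 0<max with ⊔-sel x (maxList xs)
... | inj₁ max≡x = here max≡x
... | inj₂ max≡m = there (subst (_∈ xs) (sym max≡m) (maxList-∈ xs (subst (0 <_) max≡m 0<max)))

module _ {n : ℕ} (f : Fin n → ℕ) where

  ≤-maxList-allFin : ∀ i → f i ≤ maxList (map f (allFin n))
  ≤-maxList-allFin i = ≤-maxList (∈-map⁺ f (∈-allFin i))

  maxList-allFin-≤ : ∀ {m} → (∀ i → f i ≤ m) → maxList (map f (allFin n)) ≤ m
  maxList-allFin-≤ f≤m = maxList-≤ (map f (allFin n)) λ x∈ → case ∈-map⁻ f {xs = allFin n} x∈ of λ where
    (i , _ , refl) → f≤m i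

  maxList-allFin-attained : 0 < maxList (map f (allFin n)) → ∃[ i ] maxList (map f (allFin n)) ≡ f i
  maxList-allFin-attained 0<max with ∈-map⁻ f {xs = allFin n} (maxList-∈ (map f (allFin n)) 0<max)
  ... | i , _ , max≡fi = i , max≡fi

module _ (f : ℕ → Bool) where

  findFrom-≤ : ∀ b s → findFrom f b s ≤ s + b
  findFrom-≤ zero    s = ≤-reflexive (sym (+-identityʳ s))
  findFrom-≤ (suc b) s with f s
  ... | true  = m≤m+n s (suc b)
  ... | false = ≤-trans (findFrom-≤ b (suc s)) (≤-reflexive (sym (+-suc s b)))

  findFrom-found : ∀ b s → findFrom f b s < s + b → T (f (findFrom f b s))
  findFrom-found zero    s found<s+0 = ⊥-elim (<-irrefl (sym (+-identityʳ s)) found<s+0)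
  findFrom-found (suc b) s found<s+b with f s in fs≡
  ... | true  = subst T (sym fs≡) _
  ... | false = findFrom-found b (suc s) (≤-trans found<s+b (≤-reflexive (+-suc s b)))

  findFrom-minimal : ∀ b s {j} → s ≤ j → j < s + b → T (f j) → findFrom f b s ≤ j
  findFrom-minimal zero    s s≤j j<s+0 fj = ⊥-elim (<-irrefl refl (≤-trans j<s+0 (≤-trans (≤-reflexive (+-identityʳ s)) s≤j)))
  findFrom-minimal (suc b) s s≤j j<s+b fj with f s in fs≡ | m≤n⇒m<n∨m≡n s≤j
  ... | true  | _          = s≤j
  ... | false | inj₁ s<j   = findFrom-minimal b (suc s) s<j (≤-trans j<s+b (≤-reflexive (+-suc s b))) fj
  ... | false | inj₂ refl  = ⊥-elim (subst T fs≡ fj)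

-- Walks, distances and eccentricities

-- Wrapping T (reach G k u v) in a record keeps k, u and v inferable from its type.
record Reachable {n} (G : Graph n) (k : ℕ) (u v : Fin n) : Set where
  constructor reachable
  field reachable? : T (reach G k u v)

module _ {n : ℕ} (G : Graph n) where

  EdgeLipschitz : (Fin n → ℕ) → Set
  EdgeLipschitz φ = ∀ w x → T (adj G w x) → φ x ≤ suc (φ w)

  adj-symᵀ : ∀ {u v} → T (adj G u v) → T (adj G v u)
  adj-symᵀ {u} {v} = subst T (adj-sym G u v)

  reach-refl : ∀ u → Reachable G 0 u u
  reach-refl u = reachable (≡⇒≡ᵇ (toℕ u) (toℕ u) refl)

  reach-zero : ∀ {u v} → Reachable G 0 u v → u ≡ v
  reach-zero {u} {v} (reachable r) = toℕ-injective (≡ᵇ⇒≡ (toℕ u) (toℕ v) r)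

  reach-suc : ∀ {k u v} → Reachable G k u v → Reachable G (suc k) u v
  reach-suc (reachable r) = reachable (from T-∨ (inj₁ r))

  reach-step : ∀ {k u w x} → Reachable G k u w → T (adj G w x) → Reachable G (suc k) u x
  reach-step {w = w} (reachable r) a =
    reachable (from T-∨ (inj₂ (any⁺ _ (lose (∈-allFin w) (from T-∧ (r , a))))))

  reach-last : ∀ {k u x} → Reachable G (suc k) u x →
               Reachable G k u x ⊎ ∃[ w ] (Reachable G k u w × T (adj G w x))
  reach-last {k} {u} {x} (reachable r) with to T-∨ r
  ... | inj₁ r′ = inj₁ (reachable r′)
  ... | inj₂ some with find (any⁻ _ (allFin n) some)
  ...   | w , _ , rw∧a with to T-∧ rw∧a
  ...     | rw , a = inj₂ (w , reachable rw , a)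

  reach-mono : ∀ {j k u v} → j ≤ k → Reachable G j u v → Reachable G k u v
  reach-mono {k = zero}  z≤n r = r
  reach-mono {k = suc k} j≤1+k r with m≤n⇒m<n∨m≡n j≤1+k
  ... | inj₁ j<1+k = reach-suc (reach-mono (≤-pred j<1+k) r)
  ... | inj₂ refl  = r

  reach-trans : ∀ {j k u w v} → Reachable G j u w → Reachable G k w v → Reachable G (k + j) u v
  reach-trans {k = zero}  r₁ r₂ with reach-zero r₂
  ... | refl = r₁
  reach-trans {k = suc k} r₁ r₂ with reach-last r₂
  ... | inj₁ r₂′           = reach-suc (reach-trans r₁ r₂′)
  ... | inj₂ (x , r₂′ , a) = reach-step (reach-trans r₁ r₂′) a

  reach-sym : ∀ {k u v} → Reachable G k u v → Reachable G k v u
  reach-sym {zero}  r with reach-zero r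
  ... | refl = r
  reach-sym {suc k} {u} {v} r with reach-last r
  ... | inj₁ r′           = reach-suc (reach-sym r′)
  ... | inj₂ (w , r′ , a) = subst (λ m → Reachable G m v u) (+-comm k 1)
                              (reach-trans (reach-step (reach-refl v) (adj-symᵀ a)) (reach-sym r′))

  reach-lipschitz : ∀ {φ} → EdgeLipschitz φ → ∀ {k u x} → Reachable G k u x → φ x ≤ k + φ u
  reach-lipschitz lip {zero}  r with reach-zero r
  ... | refl = ≤-refl
  reach-lipschitz lip {suc k} r with reach-last r
  ... | inj₁ r′           = m≤n⇒m≤1+n (reach-lipschitz lip r′)
  ... | inj₂ (w , r′ , a) = ≤-trans (lip _ _ a) (s≤s (reach-lipschitz lip r′))

  dist-≤ : ∀ {k u v} → Reachable G k u v → dist G u v ≤ k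
  dist-≤ {k} {u} {v} (reachable r) with k <? n
  ... | yes k<n = findFrom-minimal (λ k → reach G k u v) n 0 z≤n k<n r
  ... | no  k≮n = ≤-trans (findFrom-≤ (λ k → reach G k u v) n 0) (≮⇒≥ k≮n)

  reach-dist : Connected G → ∀ u v → Reachable G (dist G u v) u v
  reach-dist connected u v with m≤n⇒m<n∨m≡n (findFrom-≤ (λ k → reach G k u v) n 0)
  ... | inj₁ dist<n = reachable (findFrom-found (λ k → reach G k u v) n 0 dist<n)
  ... | inj₂ dist≡n = reachable (subst (λ k → T (reach G k u v)) (sym dist≡n) (from T-≡ (connected u v)))

  ≤-dist : Connected G → ∀ {φ} → EdgeLipschitz φ → ∀ u v → φ v ≤ dist G u v + φ u
  ≤-dist connected lip u v = reach-lipschitz lip (reach-dist connected u v)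

  dist≤ecc : ∀ u v → dist G u v ≤ ecc G u
  dist≤ecc u = ≤-maxList-allFin (dist G u)

  ecc≤diam : ∀ u → ecc G u ≤ diam G
  ecc≤diam = ≤-maxList-allFin (ecc G)

  diam-≤ : ∀ {m} → (∀ u v → dist G u v ≤ m) → diam G ≤ m
  diam-≤ dist≤m = maxList-allFin-≤ (ecc G) (λ u → maxList-allFin-≤ (dist G u) (dist≤m u))

  diametral-pair : 0 < diam G → ∃[ u ] ∃[ v ] dist G u v ≡ diam G
  diametral-pair 0<diam with maxList-allFin-attained (ecc G) 0<diam
  ... | u , diam≡ecc with maxList-allFin-attained (dist G u) (subst (0 <_) diam≡ecc 0<diam)
  ...   | v , ecc≡dist = u , v , sym (trans diam≡ecc ecc≡dist)

  edgeCount : ℕ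
  edgeCount = ∑[ u < n ] ∑[ v < n ] 𝟙 (adj G u v ∧ u ≺ v)

  edgeCount-≤-charged : (charge : Fin n → Fin n → Bool) →
                        (∀ {u v} → T (adj G u v) → T (u ≺ v) → T (charge u v ∨ charge v u)) →
                        edgeCount ≤ ∑[ u < n ] ∑[ v < n ] 𝟙 (adj G u v ∧ charge u v)
  edgeCount-≤-charged c covers = begin
    edgeCount
      ≤⟨ ∑-mono-≤ (λ u → ∑-mono-≤ (λ v → split u v)) ⟩
    ∑[ u < n ] ∑[ v < n ] (fwd u v + bwd v u)
      ≡⟨ trans (sum-cong-≗ {n} (λ u → ∑-distrib-+ (fwd u) (λ v → bwd v u)))
               (∑-distrib-+ (λ u → ∑[ v < n ] fwd u v) (λ u → ∑[ v < n ] bwd v u)) ⟩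
    ∑[ u < n ] ∑[ v < n ] fwd u v + ∑[ u < n ] ∑[ v < n ] bwd v u
      ≡⟨ cong (∑[ u < n ] ∑[ v < n ] fwd u v +_) (∑-comm (λ u v → bwd v u)) ⟩
    ∑[ u < n ] ∑[ v < n ] fwd u v + ∑[ u < n ] ∑[ v < n ] bwd u v
      ≡⟨ trans (sum-cong-≗ {n} (λ u → ∑-distrib-+ (fwd u) (bwd u)))
               (∑-distrib-+ (λ u → ∑[ v < n ] fwd u v) (λ u → ∑[ v < n ] bwd u v)) ⟨
    ∑[ u < n ] ∑[ v < n ] (fwd u v + bwd u v)
      ≤⟨ ∑-mono-≤ (λ u → ∑-mono-≤ (λ v →
           exclusive (adj G u v) (u ≺ v) (v ≺ u) (c u v) (λ u≺v v≺u → <-asym (≺⇒< {u} {v} u≺v) (≺⇒< {v} {u} v≺u)))) ⟩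
    ∑[ u < n ] ∑[ v < n ] 𝟙 (adj G u v ∧ c u v)
      ∎
    where
    open ≤-Reasoning
    fwd bwd : Fin n → Fin n → ℕ
    fwd u v = 𝟙 (adj G u v ∧ u ≺ v ∧ c u v)
    bwd u v = 𝟙 (adj G u v ∧ v ≺ u ∧ c u v)
    ≺⇒< : ∀ {u v : Fin n} → T (u ≺ v) → toℕ u < toℕ v
    ≺⇒< {u} {v} = <ᵇ⇒< (toℕ u) (toℕ v)
    cover : ∀ a l x y → (T a → T l → T (x ∨ y)) → 𝟙 (a ∧ l) ≤ 𝟙 (a ∧ l ∧ x) + 𝟙 (a ∧ l ∧ y)
    cover true true x y x∨y = ≤-trans (𝟙-mono {true} (λ _ → x∨y _ _)) (𝟙-∨ x y)
    cover true false x y x∨y = z≤n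
    cover false l x y x∨y = z≤n
    exclusive : ∀ a l l′ x → (T l → T l′ → ⊥) → 𝟙 (a ∧ l ∧ x) + 𝟙 (a ∧ l′ ∧ x) ≤ 𝟙 (a ∧ x)
    exclusive false l     l′    x ex = z≤n
    exclusive true  true  true  x ex = ⊥-elim (ex _ _)
    exclusive true  true  false x ex = ≤-reflexive (+-identityʳ (𝟙 x))
    exclusive true  false true  x ex = ≤-refl
    exclusive true  false false x ex = z≤n
    split : ∀ u v → 𝟙 (adj G u v ∧ u ≺ v) ≤ fwd u v + bwd v u
    split u v = subst (λ a → 𝟙 (adj G u v ∧ u ≺ v) ≤ fwd u v + 𝟙 (a ∧ u ≺ v ∧ c v u)) (adj-sym G u v)
                  (cover (adj G u v) (u ≺ v) (c u v) (c v u) covers)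

  σ₂-term : Fin n → Fin n → ℕ
  σ₂-term u v = if adj G u v ∧ u ≺ v then ecc G u * ecc G v else 0

  σ₂-term-edge : ∀ {u v} → T (adj G u v ∧ u ≺ v) → σ₂-term u v ≡ ecc G u * ecc G v
  σ₂-term-edge {u} {v} edge with adj G u v ∧ u ≺ v
  ... | true = refl

  σ₂≡∑ : σ₂ G ≡ ∑[ u < n ] ∑[ v < n ] σ₂-term u v
  σ₂≡∑ = trans (listSum-concatMap (λ u → map (σ₂-term u) (allFin n)) (allFin n))
           (trans (listSum-allFin (λ u → listSum (map (σ₂-term u) (allFin n))))
                  (sum-cong-≗ {n} (λ u → listSum-allFin (σ₂-term u))))

  σ₂≤diam²·edgeCount : σ₂ G ≤ diam G * diam G * edgeCount
  σ₂≤diam²·edgeCount = begin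
    σ₂ G
      ≡⟨ σ₂≡∑ ⟩
    ∑[ u < n ] ∑[ v < n ] σ₂-term u v
      ≤⟨ ∑-mono-≤ (λ u → ∑-mono-≤ (term≤ u)) ⟩
    ∑[ u < n ] ∑[ v < n ] (D² * 𝟙 (adj G u v ∧ u ≺ v))
      ≡⟨ sum-cong-≗ {n} (λ u → ∑-*ˡ D² (λ v → 𝟙 (adj G u v ∧ u ≺ v))) ⟩
    ∑[ u < n ] (D² * ∑[ v < n ] 𝟙 (adj G u v ∧ u ≺ v))
      ≡⟨ ∑-*ˡ D² (λ u → ∑[ v < n ] 𝟙 (adj G u v ∧ u ≺ v)) ⟩
    D² * edgeCount
      ∎
    where
    open ≤-Reasoning
    D² = diam G * diam G
    term≤ : ∀ u v → σ₂-term u v ≤ D² * 𝟙 (adj G u v ∧ u ≺ v)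
    term≤ u v with adj G u v ∧ u ≺ v
    ... | true  = ≤-trans (*-mono-≤ (ecc≤diam u) (ecc≤diam v)) (≤-reflexive (sym (*-identityʳ D²)))
    ... | false = z≤n

  clique-σ₂-≥ : ∀ {m} (P : Fin n → Bool) →
                (∀ {u v} → T (P u) → T (P v) → T (u ≺ v) → T (adj G u v)) →
                (∀ {u} → T (P u) → m ≤ ecc G u) →
                m * m * (count P C 2) ≤ σ₂ G
  clique-σ₂-≥ {m} P clique ecc≥m = begin
    m * m * (count P C 2)
      ≡⟨ cong (m * m *_) (count-pairs P) ⟨
    m * m * ∑[ u < n ] ∑[ v < n ] 𝟙 (P u ∧ P v ∧ u ≺ v)
      ≡⟨ ∑-*ˡ (m * m) (λ u → ∑[ v < n ] 𝟙 (P u ∧ P v ∧ u ≺ v)) ⟨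
    ∑[ u < n ] (m * m * ∑[ v < n ] 𝟙 (P u ∧ P v ∧ u ≺ v))
      ≡⟨ sum-cong-≗ {n} (λ u → ∑-*ˡ (m * m) (λ v → 𝟙 (P u ∧ P v ∧ u ≺ v))) ⟨
    ∑[ u < n ] ∑[ v < n ] (m * m * 𝟙 (P u ∧ P v ∧ u ≺ v))
      ≤⟨ ∑-mono-≤ (λ u → ∑-mono-≤ (term≥ u)) ⟩
    ∑[ u < n ] ∑[ v < n ] σ₂-term u v
      ≡⟨ σ₂≡∑ ⟨
    σ₂ G
      ∎
    where
    open ≤-Reasoning
    term≥ : ∀ u v → m * m * 𝟙 (P u ∧ P v ∧ u ≺ v) ≤ σ₂-term u v
    term≥ u v = *-𝟙-≤ (P u ∧ P v ∧ u ≺ v) λ t →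
      let pu , pv∧u≺v = to T-∧ t
          pv , u≺v    = to T-∧ pv∧u≺v
      in ≤-trans (*-mono-≤ (ecc≥m pu) (ecc≥m pv)) (≤-reflexive (sym (σ₂-term-edge (from T-∧ (clique pu pv u≺v , u≺v)))))

-- The upper bound

[1+m+n]∸m≡1+n : ∀ m n → suc m + n ∸ m ≡ suc n
[1+m+n]∸m≡1+n m n = trans (cong (_∸ m) (sym (+-suc m n))) (m+n∸m≡n m (suc n))

bound-split : ∀ d a → bound (suc d + a) d ≡ d * d * (d + (3 * a + a C 2))
bound-split d a = begin
  bound (suc d + a) d
    ≡⟨ cong (λ m → (m C 2) * (d * d) + 2 * (m ∸ 1) * (d * d) + d * d * d) ([1+m+n]∸m≡1+n d a) ⟩
  (suc a C 2) * (d * d) + 2 * a * (d * d) + d * d * d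
    ≡⟨ cong (λ c → c * (d * d) + 2 * a * (d * d) + d * d * d) ([1+n]C2≡n+nC2 a) ⟩
  (a + a C 2) * (d * d) + 2 * a * (d * d) + d * d * d
    ≡⟨ solve 3 (λ d a c → (a :+ c) :* (d :* d) :+ con 2 :* a :* (d :* d) :+ d :* d :* d
                          := d :* d :* (d :+ (con 3 :* a :+ c))) refl d a (a C 2) ⟩
  d * d * (d + (3 * a + a C 2))
    ∎
  where
  open ≡-Reasoning
  open +-*-Solver

module UpperBound {n : ℕ} (G : Graph n) (connected : Connected G) (0<diam : 0 < diam G) where

  D : ℕ
  D = diam G

  u₀ v₀ : Fin n
  u₀ = proj₁ (diametral-pair G 0<diam)
  v₀ = proj₁ (proj₂ (diametral-pair G 0<diam))

  level : Fin n → ℕ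
  level = dist G u₀

  level-v₀ : level v₀ ≡ D
  level-v₀ = proj₂ (proj₂ (diametral-pair G 0<diam))

  level≤D : ∀ u → level u ≤ D
  level≤D u = ≤-trans (dist≤ecc G u₀ u) (ecc≤diam G u₀)

  level-lipschitz : EdgeLipschitz G level
  level-lipschitz w x a = dist-≤ G (reach-step G (reach-dist G connected u₀ w) a)

  level-pred : ∀ {m} x → level x ≡ suc m → ∃[ w ] level w ≡ m
  level-pred {m} x ℓx≡1+m with reach-last G (subst (λ k → Reachable G k u₀ x) ℓx≡1+m (reach-dist G connected u₀ x))
  ... | inj₁ r           = ⊥-elim (1+n≰n (subst (_≤ m) ℓx≡1+m (dist-≤ G r)))
  ... | inj₂ (w , r , a) = w , ≤-antisym (dist-≤ G r) (≤-pred (subst (_≤ suc (level w)) ℓx≡1+m (level-lipschitz _ _ a)))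

  levels-below : ∀ m x → level x ≡ m → ∀ {i} → i ≤ m → ∃[ w ] level w ≡ i
  levels-below m x ℓx≡m i≤m with m≤n⇒m<n∨m≡n i≤m
  ... | inj₂ refl = x , ℓx≡m
  levels-below (suc m) x ℓx≡1+m _ | inj₁ i<1+m with level-pred x ℓx≡1+m
  ... | w , ℓw≡m = levels-below m w ℓw≡m (≤-pred i<1+m)

  -- rep i lies on level i ⊓ D, so it is only meaningful for i ≤ D.
  rep : ℕ → Fin n
  rep i = proj₁ (levels-below D v₀ level-v₀ (m⊓n≤n i D))

  level-rep : ∀ {i} → i ≤ D → level (rep i) ≡ i
  level-rep {i} i≤D = trans (proj₂ (levels-below D v₀ level-v₀ (m⊓n≤n i D))) (m≤n⇒m⊓n≡m i≤D)

  chosen : Fin n → Bool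
  chosen u = does (rep (level u) ≟ᶠ u)

  charge : Fin n → Fin n → Bool
  charge u v = if chosen u then chosen v ∧ (level u <ᵇ level v) else chosen v ∨ u ≺ v

  chosen⇒rep : ∀ {v} → T (chosen v) → rep (level v) ≡ v
  chosen⇒rep {v} = T-does⁻ (rep (level v) ≟ᶠ v)

  chosen-at-level : ∀ {v i} → T (chosen v) → level v ≡ i → v ≡ rep i
  chosen-at-level cv ℓv≡i = trans (sym (chosen⇒rep cv)) (cong rep ℓv≡i)

  charge-covers : ∀ {u v} → T (adj G u v) → T (u ≺ v) → T (charge u v ∨ charge v u)
  charge-covers {u} {v} a u≺v with chosen u in cu | chosen v in cv
  ... | true  | true  with <-cmp (level u) (level v)
  ...   | tri< ℓu<ℓv _ _ = from T-∨ (inj₁ (<⇒<ᵇ ℓu<ℓv))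
  ...   | tri> _ _ ℓv<ℓu = from T-∨ (inj₂ (<⇒<ᵇ ℓv<ℓu))
  ...   | tri≈ _ ℓu≡ℓv _ = ⊥-elim (<-irrefl (cong toℕ u≡v) (<ᵇ⇒< (toℕ u) (toℕ v) u≺v))
    where
    u≡v : u ≡ v
    u≡v = trans (sym (chosen⇒rep (subst T (sym cu) _))) (trans (cong rep ℓu≡ℓv) (chosen⇒rep (subst T (sym cv) _)))
  charge-covers a u≺v | true  | false = _
  charge-covers a u≺v | false | true  = _
  charge-covers a u≺v | false | false = from T-∨ (inj₁ u≺v)

  chosen-on-level : ∀ {i} → i ≤ D → ∑[ u < n ] 𝟙 (chosen u ∧ (level u ≡ᵇ i)) ≡ 1
  chosen-on-level {i} i≤D = trans (sum-cong-≗ {n} (λ u → 𝟙-cong (⇒rep u) (rep⇒ u))) (∑-δ (rep i))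
    where
    ⇒rep : ∀ u → T (chosen u ∧ (level u ≡ᵇ i)) → T (does (rep i ≟ᶠ u))
    ⇒rep u t with to T-∧ t
    ... | c , ℓu≡i = T-does⁺ (rep i ≟ᶠ u) (trans (cong rep (sym (≡ᵇ⇒≡ (level u) i ℓu≡i))) (chosen⇒rep c))
    rep⇒ : ∀ u → T (does (rep i ≟ᶠ u)) → T (chosen u ∧ (level u ≡ᵇ i))
    rep⇒ u t with T-does⁻ (rep i ≟ᶠ u) t
    ... | refl = from T-∧
                   (T-does⁺ (rep (level (rep i)) ≟ᶠ rep i) (cong rep (level-rep i≤D)) , ≡⇒≡ᵇ _ _ (level-rep i≤D))

  count-chosen-below : ∀ {m} → m ≤ suc D → ∑[ u < n ] 𝟙 (chosen u ∧ (level u <ᵇ m)) ≡ m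
  count-chosen-below {m} m≤1+D = begin
    ∑[ u < n ] 𝟙 (chosen u ∧ (level u <ᵇ m))
      ≡⟨ sum-cong-≗ {n} by-level ⟩
    ∑[ u < n ] ∑[ i < m ] 𝟙 (chosen u ∧ (level u ≡ᵇ toℕ i))
      ≡⟨ ∑-comm {n} {m} (λ u i → 𝟙 (chosen u ∧ (level u ≡ᵇ toℕ i))) ⟩
    ∑[ i < m ] ∑[ u < n ] 𝟙 (chosen u ∧ (level u ≡ᵇ toℕ i))
      ≡⟨ sum-cong-≗ {m} (λ i → chosen-on-level (≤-pred (≤-trans (toℕ<n i) m≤1+D))) ⟩
    ∑[ i < m ] 1
      ≡⟨ ∑-const-1 m ⟩
    m
      ∎
    where
    open ≡-Reasoning
    by-level : ∀ u → 𝟙 (chosen u ∧ (level u <ᵇ m)) ≡ ∑[ i < m ] 𝟙 (chosen u ∧ (level u ≡ᵇ toℕ i))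
    by-level u = begin
      𝟙 (chosen u ∧ (level u <ᵇ m))                       ≡⟨ 𝟙-∧ (chosen u) _ ⟩
      𝟙 (chosen u) * 𝟙 (level u <ᵇ m)                     ≡⟨ cong (𝟙 (chosen u) *_) (∑-≡ᵇ m (level u)) ⟨
      𝟙 (chosen u) * ∑[ i < m ] 𝟙 (level u ≡ᵇ toℕ i)      ≡⟨ ∑-*ˡ {m} (𝟙 (chosen u)) (λ i → 𝟙 (level u ≡ᵇ toℕ i)) ⟨
      ∑[ i < m ] (𝟙 (chosen u) * 𝟙 (level u ≡ᵇ toℕ i))    ≡⟨ sum-cong-≗ {m} (λ i → 𝟙-∧ (chosen u) _) ⟨
      ∑[ i < m ] 𝟙 (chosen u ∧ (level u ≡ᵇ toℕ i))        ∎

  A : ℕ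
  A = count (not ∘ chosen)

  n≡1+D+A : n ≡ suc D + A
  n≡1+D+A = begin
    n                                                   ≡⟨ ∑-const-1 n ⟨
    ∑[ u < n ] 1                                        ≡⟨ sum-cong-≗ {n} (λ u → 𝟙-+-not (chosen u)) ⟨
    ∑[ u < n ] (𝟙 (chosen u) + 𝟙 (not (chosen u)))      ≡⟨ ∑-distrib-+ (𝟙 ∘ chosen) (𝟙 ∘ not ∘ chosen) ⟩
    count chosen + A                                    ≡⟨ cong (_+ A) count-chosen ⟩
    suc D + A                                           ∎
    where
    open ≡-Reasoning
    count-chosen : count chosen ≡ suc D
    count-chosen = trans (sum-cong-≗ {n} (λ u → 𝟙-cong (λ c → from T-∧ (c , <⇒<ᵇ (s≤s (level≤D u))))
                                                       (proj₁ ∘ to T-∧)))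
                         (count-chosen-below ≤-refl)

  later : Fin n → ℕ
  later u = ∑[ v < n ] 𝟙 (not (chosen v) ∧ u ≺ v)

  budget : Fin n → ℕ
  budget u = if chosen u then 𝟙 (level u <ᵇ D) else 3 + later u

  chosen-neighbour : ∀ {u v} → T (adj G u v) → T (chosen v) →
                     v ≡ rep (level u ∸ 1) ⊎ v ≡ rep (level u) ⊎ v ≡ rep (suc (level u))
  chosen-neighbour {u} {v} a cv with <-cmp (level v) (level u)
  ... | tri< ℓv<ℓu _ _ = inj₁ (chosen-at-level cv (sym (cong (_∸ 1) (≤-antisym (level-lipschitz _ _ (adj-symᵀ G a)) ℓv<ℓu))))
  ... | tri≈ _ ℓv≡ℓu _ = inj₂ (inj₁ (chosen-at-level cv ℓv≡ℓu))
  ... | tri> _ _ ℓu<ℓv = inj₂ (inj₂ (chosen-at-level cv (≤-antisym (level-lipschitz _ _ a) ℓu<ℓv)))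

  upward-charge : ∀ u v → 𝟙 (adj G u v ∧ chosen v ∧ (level u <ᵇ level v)) ≤ 𝟙 (level u <ᵇ D) * δ (rep (suc (level u))) v
  upward-charge u v = ≤-trans (𝟙-mono next-level) (≤-reflexive (𝟙-∧ (level u <ᵇ D) _))
    where
    next-level : T (adj G u v ∧ chosen v ∧ (level u <ᵇ level v)) → T ((level u <ᵇ D) ∧ does (rep (suc (level u)) ≟ᶠ v))
    next-level t with to T-∧ t
    ... | a , cv∧ℓu<ℓv with to T-∧ cv∧ℓu<ℓv
    ...   | cv , ℓu<ᵇℓv = let ℓu<ℓv = <ᵇ⇒< (level u) (level v) ℓu<ᵇℓv in
      from T-∧ (<⇒<ᵇ (≤-trans ℓu<ℓv (level≤D v)) ,
                T-does⁺ (rep (suc (level u)) ≟ᶠ v) (sym (chosen-at-level cv (≤-antisym (level-lipschitz _ _ a) ℓu<ℓv))))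

  sideways-charge : ∀ u v → 𝟙 (adj G u v ∧ (chosen v ∨ u ≺ v)) ≤
                    δ (rep (level u ∸ 1)) v + (δ (rep (level u)) v + (δ (rep (suc (level u))) v + 𝟙 (not (chosen v) ∧ u ≺ v)))
  sideways-charge u v = split (adj G u v) (chosen v) (u ≺ v)
                          (does (rep (level u ∸ 1) ≟ᶠ v)) (does (rep (level u) ≟ᶠ v)) (does (rep (suc (level u)) ≟ᶠ v)) three-levels
    where
    split : ∀ a c l d₋ d₀ d₊ → (T a → T c → T d₋ ⊎ T d₀ ⊎ T d₊) →
            𝟙 (a ∧ (c ∨ l)) ≤ 𝟙 d₋ + (𝟙 d₀ + (𝟙 d₊ + 𝟙 (not c ∧ l)))
    split false c     l d₋ d₀ d₊ nbr = z≤n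
    split true  false l d₋ d₀ d₊ nbr = ≤-trans (m≤n+m (𝟙 l) (𝟙 d₊)) (≤-trans (m≤n+m _ (𝟙 d₀)) (m≤n+m _ (𝟙 d₋)))
    split true  true  l d₋ d₀ d₊ nbr with nbr _ _
    ... | inj₁ t        = ≤-trans (𝟙-mono {true} (λ _ → t)) (m≤m+n (𝟙 d₋) _)
    ... | inj₂ (inj₁ t) = ≤-trans (𝟙-mono {true} (λ _ → t)) (≤-trans (m≤m+n (𝟙 d₀) _) (m≤n+m _ (𝟙 d₋)))
    ... | inj₂ (inj₂ t) = ≤-trans (𝟙-mono {true} (λ _ → t))
                            (≤-trans (m≤m+n (𝟙 d₊) _) (≤-trans (m≤n+m _ (𝟙 d₀)) (m≤n+m _ (𝟙 d₋))))
    three-levels : T (adj G u v) → T (chosen v) →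
                   T (does (rep (level u ∸ 1) ≟ᶠ v)) ⊎ T (does (rep (level u) ≟ᶠ v)) ⊎ T (does (rep (suc (level u)) ≟ᶠ v))
    three-levels a cv with chosen-neighbour a cv
    ... | inj₁ v≡rep        = inj₁ (T-does⁺ (rep (level u ∸ 1) ≟ᶠ v) (sym v≡rep))
    ... | inj₂ (inj₁ v≡rep) = inj₂ (inj₁ (T-does⁺ (rep (level u) ≟ᶠ v) (sym v≡rep)))
    ... | inj₂ (inj₂ v≡rep) = inj₂ (inj₂ (T-does⁺ (rep (suc (level u)) ≟ᶠ v) (sym v≡rep)))

  charge≤budget : ∀ u → ∑[ v < n ] 𝟙 (adj G u v ∧ charge u v) ≤ budget u
  charge≤budget u with chosen u
  ... | true  = begin
    ∑[ v < n ] 𝟙 (adj G u v ∧ chosen v ∧ (level u <ᵇ level v))   ≤⟨ ∑-mono-≤ (upward-charge u) ⟩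
    ∑[ v < n ] (𝟙 (level u <ᵇ D) * δ (rep (suc (level u))) v)    ≡⟨ ∑-*ˡ (𝟙 (level u <ᵇ D)) (δ (rep (suc (level u)))) ⟩
    𝟙 (level u <ᵇ D) * ∑[ v < n ] δ (rep (suc (level u))) v      ≡⟨ cong (𝟙 (level u <ᵇ D) *_) (∑-δ (rep (suc (level u)))) ⟩
    𝟙 (level u <ᵇ D) * 1                                         ≡⟨ *-identityʳ _ ⟩
    𝟙 (level u <ᵇ D)                                             ∎
    where open ≤-Reasoning
  ... | false = begin
    ∑[ v < n ] 𝟙 (adj G u v ∧ (chosen v ∨ u ≺ v))
      ≤⟨ ∑-mono-≤ (sideways-charge u) ⟩
    ∑[ v < n ] (δ₋ v + (δ₀ v + (δ₊ v + after v)))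
      ≡⟨ ∑-distrib-+ δ₋ (λ v → δ₀ v + (δ₊ v + after v)) ⟩
    ∑[ v < n ] δ₋ v + ∑[ v < n ] (δ₀ v + (δ₊ v + after v))
      ≡⟨ cong (∑[ v < n ] δ₋ v +_) (∑-distrib-+ δ₀ (λ v → δ₊ v + after v)) ⟩
    ∑[ v < n ] δ₋ v + (∑[ v < n ] δ₀ v + ∑[ v < n ] (δ₊ v + after v))
      ≡⟨ cong (λ x → ∑[ v < n ] δ₋ v + (∑[ v < n ] δ₀ v + x)) (∑-distrib-+ δ₊ after) ⟩
    ∑[ v < n ] δ₋ v + (∑[ v < n ] δ₀ v + (∑[ v < n ] δ₊ v + later u))
      ≡⟨ cong₂ _+_ (∑-δ (rep (level u ∸ 1))) (cong₂ _+_ (∑-δ (rep (level u))) (cong (_+ later u) (∑-δ (rep (suc (level u)))))) ⟩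
    3 + later u
      ∎
    where
    open ≤-Reasoning
    δ₋ δ₀ δ₊ after : Fin n → ℕ
    δ₋ = δ (rep (level u ∸ 1))
    δ₀ = δ (rep (level u))
    δ₊ = δ (rep (suc (level u)))
    after v = 𝟙 (not (chosen v) ∧ u ≺ v)

  ∑-budget : ∑[ u < n ] budget u ≡ D + (3 * A + A C 2)
  ∑-budget = begin
    ∑[ u < n ] budget u
      ≡⟨ sum-cong-≗ {n} budget-split ⟩
    ∑[ u < n ] (𝟙 (chosen u ∧ (level u <ᵇ D)) + (3 * 𝟙 (not (chosen u)) + 𝟙 (not (chosen u)) * later u))
      ≡⟨ trans (∑-distrib-+ (λ u → 𝟙 (chosen u ∧ (level u <ᵇ D))) _)
               (cong (∑[ u < n ] 𝟙 (chosen u ∧ (level u <ᵇ D)) +_)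
                     (∑-distrib-+ (λ u → 3 * 𝟙 (not (chosen u))) (λ u → 𝟙 (not (chosen u)) * later u))) ⟩
    ∑[ u < n ] 𝟙 (chosen u ∧ (level u <ᵇ D)) + (∑[ u < n ] (3 * 𝟙 (not (chosen u))) + ∑[ u < n ] (𝟙 (not (chosen u)) * later u))
      ≡⟨ cong₂ _+_ (count-chosen-below (n≤1+n D)) (cong₂ _+_ (∑-*ˡ 3 (𝟙 ∘ not ∘ chosen)) unchosen-pairs) ⟩
    D + (3 * A + A C 2)
      ∎
    where
    open ≡-Reasoning
    budget-split : ∀ u → budget u ≡ 𝟙 (chosen u ∧ (level u <ᵇ D)) + (3 * 𝟙 (not (chosen u)) + 𝟙 (not (chosen u)) * later u)
    budget-split u with chosen u
    ... | true  = sym (+-identityʳ _)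
    ... | false = cong (3 +_) (sym (+-identityʳ (later u)))
    unchosen-pairs : ∑[ u < n ] (𝟙 (not (chosen u)) * later u) ≡ A C 2
    unchosen-pairs = begin
      ∑[ u < n ] (𝟙 (not (chosen u)) * later u)
        ≡⟨ sum-cong-≗ {n} (λ u → ∑-*ˡ (𝟙 (not (chosen u))) (λ v → 𝟙 (not (chosen v) ∧ u ≺ v))) ⟨
      ∑[ u < n ] ∑[ v < n ] (𝟙 (not (chosen u)) * 𝟙 (not (chosen v) ∧ u ≺ v))
        ≡⟨ sum-cong-≗ {n} (λ u → sum-cong-≗ {n} (λ v → 𝟙-∧ (not (chosen u)) _)) ⟨
      ∑[ u < n ] ∑[ v < n ] 𝟙 (not (chosen u) ∧ not (chosen v) ∧ u ≺ v)
        ≡⟨ count-pairs (not ∘ chosen) ⟩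
      A C 2
        ∎

  edgeCount≤ : edgeCount G ≤ D + (3 * A + A C 2)
  edgeCount≤ = begin
    edgeCount G                                       ≤⟨ edgeCount-≤-charged G charge charge-covers ⟩
    ∑[ u < n ] ∑[ v < n ] 𝟙 (adj G u v ∧ charge u v)  ≤⟨ ∑-mono-≤ charge≤budget ⟩
    ∑[ u < n ] budget u                               ≡⟨ ∑-budget ⟩
    D + (3 * A + A C 2)                               ∎
    where open ≤-Reasoning

  σ₂≤bound : σ₂ G ≤ bound n D
  σ₂≤bound = begin
    σ₂ G                              ≤⟨ σ₂≤diam²·edgeCount G ⟩
    D * D * edgeCount G               ≤⟨ *-monoʳ-≤ (D * D) edgeCount≤ ⟩
    D * D * (D + (3 * A + A C 2))     ≡⟨ bound-split D A ⟨
    bound (suc D + A) D               ≡⟨ cong (λ m → bound m D) n≡1+D+A ⟨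
    bound n D                         ∎
    where open ≤-Reasoning

-- The graphs B_{n,d} and B′_{n,d}

module _ {t d : ℕ} where

  adjBℕ-path : ∀ {a b} → a ≤ d → b ≤ d → adjBℕ t d a b ≡ (absDiff a b ≡ᵇ 1)
  adjBℕ-path {a} {b} a≤d b≤d with a ≤ᵇ d in p | b ≤ᵇ d in q
  ... | true  | true  = refl
  ... | false | _     = ⊥-elim (subst T p (≤⇒≤ᵇ a≤d))
  ... | true  | false = ⊥-elim (subst T q (≤⇒≤ᵇ b≤d))

  adjBℕ-hang : ∀ {a b} → d < a → b ≤ d → adjBℕ t d a b ≡ (suc b ≤ᵇ t)
  adjBℕ-hang {a} {b} d<a b≤d with a ≤ᵇ d in p | b ≤ᵇ d in q
  ... | false | true  = refl
  ... | true  | _     = ⊥-elim (<⇒≱ d<a (≤ᵇ⇒≤ a d (subst T (sym p) _)))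
  ... | false | false = ⊥-elim (subst T q (≤⇒≤ᵇ b≤d))

  adjBℕ-clique : ∀ {a b} → d < a → d < b → adjBℕ t d a b ≡ not (a ≡ᵇ b)
  adjBℕ-clique {a} {b} d<a d<b with a ≤ᵇ d in p | b ≤ᵇ d in q
  ... | false | false = refl
  ... | true  | _     = ⊥-elim (<⇒≱ d<a (≤ᵇ⇒≤ a d (subst T (sym p) _)))
  ... | false | true  = ⊥-elim (<⇒≱ d<b (≤ᵇ⇒≤ b d (subst T (sym q) _)))

absDiff-suc : ∀ i → absDiff i (suc i) ≡ 1
absDiff-suc zero    = refl
absDiff-suc (suc i) = absDiff-suc i

count-above : ∀ n m → ∑[ u < n ] 𝟙 (m <ᵇ toℕ u) ≡ n ∸ suc m
count-above zero    m       = refl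
count-above (suc n) zero    = ∑-const-1 n
count-above (suc n) (suc m) = count-above n m

module Extremal (t : ℕ) (2≤t : 2 ≤ t) (t≤3 : t ≤ 3) {n d : ℕ} (2≤d : 2 ≤ d) (d<n : d < n) where

  G : Graph n
  G = Bgraph t n d

  Clique : Fin n → Bool
  Clique x = d <ᵇ toℕ x

  -- The clique is placed at height t ∸ 2, within one of each of its neighbours v₀, …, v_{t−1}.
  height : Fin n → ℕ
  height x = if toℕ x ≤ᵇ d then toℕ x else t ∸ 2

  height-lipschitz : EdgeLipschitz G height
  height-lipschitz w x a with toℕ w ≤ᵇ d in p | toℕ x ≤ᵇ d in q
  ... | true  | true  = ≤-trans (m≤n+m∸n (toℕ x) (toℕ w))
                          (≤-trans (+-monoʳ-≤ (toℕ w) (≤-trans (m≤n+m (toℕ x ∸ toℕ w) (toℕ w ∸ toℕ x))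
                                                               (≤-reflexive (≡ᵇ⇒≡ _ 1 a))))
                                   (≤-reflexive (+-comm (toℕ w) 1)))
  ... | true  | false = ≤-trans (∸-monoˡ-≤ 2 t≤3) (s≤s z≤n)
  ... | false | true  = ≤-pred (≤-trans (≤ᵇ⇒≤ (suc (toℕ x)) t a) (m≤n+m∸n t 2))
  ... | false | false = n≤1+n (t ∸ 2)

  path-adj : ∀ {i} {x y : Fin n} → toℕ x ≡ i → toℕ y ≡ suc i → suc i ≤ d → T (adj G x y)
  path-adj {i} x≡i y≡1+i 1+i≤d
    rewrite x≡i | y≡1+i | adjBℕ-path {t} {d} (≤-trans (n≤1+n i) 1+i≤d) 1+i≤d | absDiff-suc i = _

  hang-adj : ∀ {x y : Fin n} → T (Clique x) → toℕ y < t → T (adj G x y)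
  hang-adj {x} {y} cx y<t = subst T (sym (adjBℕ-hang (<ᵇ⇒< d (toℕ x) cx) y≤d)) (≤⇒≤ᵇ y<t)
    where
    y≤d : toℕ y ≤ d
    y≤d = ≤-trans (≤-pred (≤-trans y<t t≤3)) 2≤d

  clique-adj : ∀ {x y : Fin n} → T (Clique x) → T (Clique y) → toℕ x ≢ toℕ y → T (adj G x y)
  clique-adj {x} {y} cx cy x≢y =
    subst T (sym (adjBℕ-clique (<ᵇ⇒< d (toℕ x) cx) (<ᵇ⇒< d (toℕ y) cy)))
      (from T-not-≡ (dec-false (toℕ x ≟ toℕ y) x≢y))

  along-path : ∀ m {i} {x y : Fin n} → toℕ x ≡ i → toℕ y ≡ i + m → i + m ≤ d → Reachable G m x y
  along-path zero    {i} {x} x≡i y≡i+0 _ =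
    subst (Reachable G 0 x) (toℕ-injective (trans x≡i (trans (sym (+-identityʳ i)) (sym y≡i+0)))) (reach-refl G x)
  along-path (suc m) {i} x≡i y≡i+1+m i+1+m≤d =
    reach-step G (along-path m x≡i (toℕ-fromℕ< i+m<n) (<⇒≤ 1+i+m≤d))
                 (path-adj (toℕ-fromℕ< i+m<n) (trans y≡i+1+m (+-suc i m)) 1+i+m≤d)
    where
    1+i+m≤d : suc (i + m) ≤ d
    1+i+m≤d = subst (_≤ d) (+-suc i m) i+1+m≤d
    i+m<n : i + m < n
    i+m<n = ≤-trans 1+i+m≤d (<⇒≤ d<n)

  path-to-path : ∀ {x y : Fin n} → toℕ x ≤ toℕ y → toℕ y ≤ d → Reachable G d x y
  path-to-path {x} {y} x≤y y≤d =
    reach-mono G (≤-trans (m∸n≤m (toℕ y) (toℕ x)) y≤d)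
      (along-path (toℕ y ∸ toℕ x) refl (sym (m+[n∸m]≡n x≤y)) (subst (_≤ d) (sym (m+[n∸m]≡n x≤y)) y≤d))

  clique-to-path : ∀ {x y : Fin n} → T (Clique x) → toℕ y ≤ d → Reachable G d x y
  clique-to-path {x} {y} cx y≤d with toℕ y in y≡
  ... | zero  = reach-mono G (≤-trans (s≤s z≤n) 2≤d)
                  (reach-step G (reach-refl G x) (hang-adj {x} cx (subst (_< t) (sym y≡) (≤-trans (s≤s z≤n) 2≤t))))
  ... | suc b = reach-mono G (subst (_≤ d) (+-comm 1 b) y≤d)
                  (reach-trans G (reach-step G (reach-refl G x) (hang-adj {x} cx (subst (_< t) (sym v₁≡1) 2≤t)))
                                 (along-path b v₁≡1 y≡ y≤d))
    where
    1<n : 1 < n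
    1<n = ≤-trans 2≤d (<⇒≤ d<n)
    v₁≡1 : toℕ (fromℕ< 1<n) ≡ 1
    v₁≡1 = toℕ-fromℕ< 1<n

  clique-to-clique : ∀ {x y : Fin n} → T (Clique x) → T (Clique y) → Reachable G d x y
  clique-to-clique {x} {y} cx cy with toℕ x ≟ toℕ y
  ... | yes x≡y = subst (Reachable G d x) (toℕ-injective x≡y) (reach-mono G z≤n (reach-refl G x))
  ... | no  x≢y = reach-mono G (≤-trans (s≤s z≤n) 2≤d) (reach-step G (reach-refl G x) (clique-adj {x} {y} cx cy x≢y))

  within-d : ∀ x y → Reachable G d x y
  within-d x y with toℕ x ≤? d | toℕ y ≤? d
  ... | yes x≤d | yes y≤d with ≤-total (toℕ x) (toℕ y)
  ...   | inj₁ x≤y = path-to-path x≤y y≤d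
  ...   | inj₂ y≤x = reach-sym G (path-to-path y≤x x≤d)
  within-d x y | yes x≤d | no  y≰d = reach-sym G (clique-to-path (<⇒<ᵇ (≰⇒> y≰d)) x≤d)
  within-d x y | no  x≰d | yes y≤d = clique-to-path (<⇒<ᵇ (≰⇒> x≰d)) y≤d
  within-d x y | no  x≰d | no  y≰d = clique-to-clique (<⇒<ᵇ (≰⇒> x≰d)) (<⇒<ᵇ (≰⇒> y≰d))

  connected : Connected G
  connected u v = to T-≡ (Reachable.reachable? (reach-mono G (<⇒≤ d<n) (within-d u v)))

  height-path : ∀ {x} → toℕ x ≤ d → height x ≡ toℕ x
  height-path {x} x≤d with toℕ x ≤ᵇ d in p
  ... | true  = refl
  ... | false = ⊥-elim (subst T p (≤⇒≤ᵇ x≤d))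

  height-clique : ∀ {x} → T (Clique x) → height x ≡ t ∸ 2
  height-clique {x} cx with toℕ x ≤ᵇ d in p
  ... | true  = ⊥-elim (<⇒≱ (<ᵇ⇒< d (toℕ x) cx) (≤ᵇ⇒≤ (toℕ x) d (subst T (sym p) _)))
  ... | false = refl

  v-end : Fin n
  v-end = fromℕ< d<n

  d≤dist+height : ∀ x → d ≤ dist G x v-end + height x
  d≤dist+height x = subst (_≤ dist G x v-end + height x) height-end (≤-dist G connected height-lipschitz x v-end)
    where
    height-end : height v-end ≡ d
    height-end = trans (height-path (≤-reflexive (toℕ-fromℕ< d<n))) (toℕ-fromℕ< d<n)

  diam≡d : diam G ≡ d
  diam≡d = ≤-antisym (diam-≤ G (λ u v → dist-≤ G (within-d u v))) (begin
    d                          ≤⟨ d≤dist+height v₀ ⟩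
    dist G v₀ v-end + height v₀ ≡⟨ trans (cong (dist G v₀ v-end +_) height-v₀) (+-identityʳ _) ⟩
    dist G v₀ v-end            ≤⟨ dist≤ecc G v₀ v-end ⟩
    ecc G v₀                   ≤⟨ ecc≤diam G v₀ ⟩
    diam G                     ∎)
    where
    open ≤-Reasoning
    0<n : 0 < n
    0<n = ≤-trans (s≤s z≤n) d<n
    v₀ : Fin n
    v₀ = fromℕ< 0<n
    height-v₀ : height v₀ ≡ 0
    height-v₀ = trans (height-path (≤-trans (≤-reflexive (toℕ-fromℕ< 0<n)) z≤n)) (toℕ-fromℕ< 0<n)

  clique-ecc : ∀ {x} → T (Clique x) → d ≤ ecc G x + (t ∸ 2)
  clique-ecc {x} cx = ≤-trans (d≤dist+height x) (+-mono-≤ (dist≤ecc G x v-end) (≤-reflexive (height-clique {x} cx)))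

Bgraph-σ₂≤bound : ∀ {t n d} → 2 ≤ t → t ≤ 3 → 2 ≤ d → d < n → σ₂ (Bgraph t n d) ≤ bound n d
Bgraph-σ₂≤bound {t} {n} 2≤t t≤3 2≤d d<n =
  subst (λ D → σ₂ G ≤ bound n D) diam≡d
        (UpperBound.σ₂≤bound G connected (subst (0 <_) (sym diam≡d) (≤-trans (s≤s z≤n) 2≤d)))
  where open Extremal t 2≤t t≤3 2≤d d<n

B-clique-σ₂-≥ : ∀ {n d} → 2 ≤ d → d < n → d * d * ((n ∸ suc d) C 2) ≤ σ₂ (B n d)
B-clique-σ₂-≥ {n} {d} 2≤d d<n =
  subst (λ c → d * d * (c C 2) ≤ σ₂ G) (count-above n d)
        (clique-σ₂-≥ G Clique (λ {u} {v} cu cv u≺v → clique-adj {u} {v} cu cv (<⇒≢ (<ᵇ⇒< (toℕ u) (toℕ v) u≺v)))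
                              (λ {u} cu → subst (d ≤_) (+-identityʳ (ecc G u)) (clique-ecc {u} cu)))
  where open Extremal 2 ≤-refl (s≤s (s≤s z≤n)) 2≤d d<n

-- Asymptotic sharpness

2*nC2+n≡n*n : ∀ a → 2 * (a C 2) + a ≡ a * a
2*nC2+n≡n*n zero    = refl
2*nC2+n≡n*n (suc a) = begin
  2 * (suc a C 2) + suc a
    ≡⟨ cong (λ c → 2 * c + suc a) ([1+n]C2≡n+nC2 a) ⟩
  2 * (a + a C 2) + suc a
    ≡⟨ solve 2 (λ a c → con 2 :* (a :+ c) :+ (con 1 :+ a) := (con 2 :* c :+ a) :+ (con 1 :+ con 2 :* a)) refl a (a C 2) ⟩
  (2 * (a C 2) + a) + (1 + 2 * a)
    ≡⟨ cong (_+ (1 + 2 * a)) (2*nC2+n≡n*n a) ⟩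
  a * a + (1 + 2 * a)
    ≡⟨ solve 1 (λ a → a :* a :+ (con 1 :+ con 2 :* a) := (con 1 :+ a) :* (con 1 :+ a)) refl a ⟩
  suc a * suc a
    ∎
  where
  open ≡-Reasoning
  open +-*-Solver

linear≤C2 : ∀ K a → 4 * K < a → K * suc a ≤ a C 2
linear≤C2 K a 4K<a = *-cancelˡ-≤ 2 (+-cancelʳ-≤ a (2 * (K * suc a)) (2 * (a C 2)) (begin
  2 * (K * suc a) + a
    ≡⟨ solve 2 (λ K a → con 2 :* (K :* (con 1 :+ a)) :+ a := con 2 :* K :+ (con 2 :* (K :* a) :+ a)) refl K a ⟩
  2 * K + (2 * (K * a) + a)
    ≤⟨ +-monoˡ-≤ _ (*-monoʳ-≤ 2 (m≤m*n K a)) ⟩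
  2 * (K * a) + (2 * (K * a) + a)
    ≡⟨ solve 2 (λ K a → con 2 :* (K :* a) :+ (con 2 :* (K :* a) :+ a) := (con 1 :+ con 4 :* K) :* a) refl K a ⟩
  suc (4 * K) * a
    ≤⟨ *-monoˡ-≤ a 4K<a ⟩
  a * a
    ≡⟨ 2*nC2+n≡n*n a ⟨
  2 * (a C 2) + a
    ∎))
  where
  open ≤-Reasoning
  open +-*-Solver
  instance
    a-nonZero : NonZero a
    a-nonZero = >-nonZero (≤-trans (s≤s z≤n) 4K<a)

scaled-bound≤ : ∀ k d a → k * (d + 3 * a) ≤ a C 2 → k * bound (suc d + a) d ≤ suc k * (d * d * (a C 2))
scaled-bound≤ k d a k[d+3a]≤C = begin
  k * bound (suc d + a) d
    ≡⟨ cong (k *_) (bound-split d a) ⟩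
  k * (d * d * (d + (3 * a + c)))
    ≡⟨ solve 4 (λ k d a c → k :* (d :* d :* (d :+ (con 3 :* a :+ c)))
                            := d :* d :* (k :* (d :+ con 3 :* a)) :+ d :* d :* (k :* c)) refl k d a c ⟩
  d * d * (k * (d + 3 * a)) + d * d * (k * c)
    ≤⟨ +-monoˡ-≤ (d * d * (k * c)) (*-monoʳ-≤ (d * d) k[d+3a]≤C) ⟩
  d * d * c + d * d * (k * c)
    ≡⟨ solve 3 (λ k d c → d :* d :* c :+ d :* d :* (k :* c) := (con 1 :+ k) :* (d :* d :* c)) refl k d c ⟩
  suc k * (d * d * c)
    ∎
  where
  open ≤-Reasoning
  open +-*-Solver
  c = a C 2

module _ {p q n d : ℕ} (p<q : p < q) (dq≤pn : d * q ≤ p * n) where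

  diameter<order : 0 < n → d < n
  diameter<order 0<n = ≰⇒> λ n≤d → <⇒≱ p<q (*-cancelˡ-≤ n (begin
    n * q  ≤⟨ *-monoˡ-≤ q n≤d ⟩
    d * q  ≤⟨ dq≤pn ⟩
    p * n  ≡⟨ *-comm p n ⟩
    n * p  ∎))
    where
    open ≤-Reasoning
    instance
      n-nonZero : NonZero n
      n-nonZero = >-nonZero 0<n

  order≤q*[order∸diameter] : n ≤ q * (n ∸ d)
  order≤q*[order∸diameter] = begin
    n              ≡⟨ *-identityˡ n ⟨
    1 * n          ≤⟨ *-monoˡ-≤ n (m<n⇒0<n∸m p<q) ⟩
    (q ∸ p) * n    ≡⟨ *-distribʳ-∸ n q p ⟩
    q * n ∸ p * n  ≤⟨ ∸-monoʳ-≤ (q * n) (≤-trans (≤-reflexive (*-comm q d)) dq≤pn) ⟩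
    q * n ∸ q * d  ≡⟨ *-distribˡ-∸ q n d ⟨
    q * (n ∸ d)    ∎
    where open ≤-Reasoning

sharpness : ∀ p q → p < q → ∀ k → ∃[ N ] ∀ n d → N ≤ n → 2 ≤ d → d * q ≤ p * n →
            k * bound n d ≤ suc k * (σ₂ (B n d) ⊔ σ₂ (B′ n d)) × σ₂ (B n d) ⊔ σ₂ (B′ n d) ≤ bound n d
sharpness p q p<q k = q * suc (suc (4 * K)) , large
  where
  -- This N forces 4K < n − d − 1, which is what linear≤C2 needs.
  K : ℕ
  K = k * (q + 3)
  instance
    q-nonZero : NonZero q
    q-nonZero = >-nonZero (≤-trans (s≤s z≤n) p<q)
  large : ∀ n d → q * suc (suc (4 * K)) ≤ n → 2 ≤ d → d * q ≤ p * n →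
          k * bound n d ≤ suc k * (σ₂ (B n d) ⊔ σ₂ (B′ n d)) × σ₂ (B n d) ⊔ σ₂ (B′ n d) ≤ bound n d
  large n d N≤n 2≤d dq≤pn = lower , ⊔-lub (Bgraph-σ₂≤bound {2} {n} {d} ≤-refl (s≤s (s≤s z≤n)) 2≤d d<n)
                                          (Bgraph-σ₂≤bound {3} {n} {d} (s≤s (s≤s z≤n)) ≤-refl 2≤d d<n)
    where
    d<n : d < n
    d<n = diameter<order {p} {q} {n} {d} p<q dq≤pn (≤-trans (≤-trans (≤-trans (s≤s z≤n) p<q) (m≤m*n q (suc (suc (4 * K))))) N≤n)
    a : ℕ
    a = n ∸ suc d
    n≡1+d+a : n ≡ suc d + a
    n≡1+d+a = sym (m+[n∸m]≡n d<n)
    n≤q[1+a] : n ≤ q * suc a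
    n≤q[1+a] = subst (λ m → n ≤ q * m) (trans (cong (_∸ d) n≡1+d+a) ([1+m+n]∸m≡1+n d a))
                     (order≤q*[order∸diameter] {p} {q} {n} {d} p<q dq≤pn)
    4K<a : 4 * K < a
    4K<a = ≤-pred (*-cancelˡ-≤ q (≤-trans N≤n n≤q[1+a]))
    k[d+3a]≤C : k * (d + 3 * a) ≤ a C 2
    k[d+3a]≤C = begin
      k * (d + 3 * a)
        ≤⟨ *-monoʳ-≤ k (+-mono-≤ (≤-trans (<⇒≤ d<n) n≤q[1+a]) (*-monoʳ-≤ 3 (n≤1+n a))) ⟩
      k * (q * suc a + 3 * suc a)
        ≡⟨ solve 3 (λ k q s → k :* (q :* s :+ con 3 :* s) := k :* (q :+ con 3) :* s) refl k q (suc a) ⟩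
      K * suc a
        ≤⟨ linear≤C2 K a 4K<a ⟩
      a C 2
        ∎
      where
      open ≤-Reasoning
      open +-*-Solver
    lower : k * bound n d ≤ suc k * (σ₂ (B n d) ⊔ σ₂ (B′ n d))
    lower = begin
      k * bound n d               ≡⟨ cong (λ m → k * bound m d) n≡1+d+a ⟩
      k * bound (suc d + a) d     ≤⟨ scaled-bound≤ k d a k[d+3a]≤C ⟩
      suc k * (d * d * (a C 2))   ≤⟨ *-monoʳ-≤ (suc k) (≤-trans (B-clique-σ₂-≥ {n} {d} 2≤d d<n) (m≤m⊔n (σ₂ (B n d)) (σ₂ (B′ n d)))) ⟩
      suc k * (σ₂ (B n d) ⊔ σ₂ (B′ n d)) ∎
      where open ≤-Reasoning

theorem2p11 : (∀ (n : ℕ) (G : Graph n) → Connected G → 2 ≤ diam G →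
    σ₂ G ≤ bound n (diam G))
    ×
    (∀ (p q : ℕ) → 0 < p → p < q → ∀ (k : ℕ) → 1 ≤ k →
    ∃[ N ] ∀ (n d : ℕ) → N ≤ n → 2 ≤ d → d * q ≤ p * n →
    ((k ∸ 1) * bound n d ≤ k * (σ₂ (B n d) ⊔ σ₂ (B′ n d)))
    × (k * (σ₂ (B n d) ⊔ σ₂ (B′ n d)) ≤ (k + 1) * bound n d))
theorem2p11 =
  (λ n G connected 2≤diam → UpperBound.σ₂≤bound G connected (≤-trans (s≤s z≤n) 2≤diam)) ,
  λ where
    p q _ p<q zero    ()
    p q _ p<q (suc k) _ →
      let N , near = sharpness p q p<q k in
      N , λ n d N≤n 2≤d dq≤pn →
        let lower , max≤bound = near n d N≤n 2≤d dq≤pn in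
        lower , ≤-trans (*-monoʳ-≤ (suc k) max≤bound) (*-monoˡ-≤ (bound n d) (m≤m+n (suc k) 1))
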